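{- Let $\mathbf A$ be a semi-Heyting algebra satisfying $x^*\to y^*\approx y^*\to x^*$. Then $\mathbf A$ satisfies $(x^*\to x)^*\approx1$.
   Context: A semi-Heyting algebra is an algebra $\langle A;\wedge,\vee,\to,0,1\rangle$ such that $\langle A;\wedge,\vee,0,1\rangle$ is a bounded lattice and the identities $x\wedge(x\to y)\approx x\wedge y$, $x\wedge(y\to z)\approx x\wedge((x\wedge y)\to(x\wedge z))$, $x\to x\approx1$ hold. Write $x^*:=x\to0$. -}

module Defs where

open import Level using (Level; suc; _⊔_)
open import Relation.Binary.Core using (Rel)
open import Algebra.Core using (Op₂)
open import Algebra.Definitions using (Congruent₂)
open import Algebra.Lattice.Structures using (IsLattice)

record SemiHeytingAlgebra (c ℓ : Level) : Set (suc (c ⊔ ℓ)) where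
  infixr 5 _⇒_
  infixr 6 _∨_
  infixr 7 _∧_
  infix  4 _≈_
  field
    Carrier   : Set c
    _≈_       : Rel Carrier ℓ
    _∨_       : Op₂ Carrier
    _∧_       : Op₂ Carrier
    _⇒_       : Op₂ Carrier
    ⊥ ⊤       : Carrier
    isLattice : IsLattice _≈_ _∨_ _∧_
    ⇒-cong    : Congruent₂ _≈_ _⇒_
    ⊥-least   : ∀ x → ⊥ ∧ x ≈ ⊥
    ⊤-greatest : ∀ x → ⊤ ∧ x ≈ x
    sh₁       : ∀ x y → x ∧ (x ⇒ y) ≈ x ∧ y
    sh₂       : ∀ x y z → x ∧ (y ⇒ z) ≈ x ∧ ((x ∧ y) ⇒ (x ∧ z))
    sh₃       : ∀ x → x ⇒ x ≈ ⊤

  open IsLattice isLattice public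

  _* : Carrier → Carrier
  x * = x ⇒ ⊥

{-# OPTIONS --safe #-}
module Submission where

open import Defs
open import Level using (Level)
open import Algebra.Lattice.Bundles using (Lattice)
import Algebra.Lattice.Properties.Lattice as LatticeProperties
import Relation.Binary.Reasoning.Setoid as SetoidReasoning

-- Put a := x* → x. By the relativisation identity sh₂, x ∧ a depends only on
-- x ∧ x* = 0 and x ∧ x = x, so x ∧ a = x ∧ (0 → 1); and x* ∧ a = x* ∧ x = 0.
-- The hypothesis, applied to 1* = 0 and 0* = 1, forces 0 → 1 = 0, so a is
-- disjoint from both x and x*. Disjointness from x gives a ≤ x*, hence
-- a = a ∧ x* = 0 and a* = 0 → 0 = 1.

module SemiHeytingAlgebraProperties {c ℓ : Level} (A : SemiHeytingAlgebra c ℓ) where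
  open SemiHeytingAlgebra A

  lattice : Lattice c ℓ
  lattice = record { isLattice = isLattice }

  open Lattice lattice public using (setoid)
  open LatticeProperties lattice using (∧-idem)
  open SetoidReasoning setoid

  x∧⊥≈⊥ : ∀ x → x ∧ ⊥ ≈ ⊥
  x∧⊥≈⊥ x = trans (∧-comm x ⊥) (⊥-least x)

  x∧⊤≈x : ∀ x → x ∧ ⊤ ≈ x
  x∧⊤≈x x = trans (∧-comm x ⊤) (⊤-greatest x)

  ⊤⇒x≈x : ∀ x → ⊤ ⇒ x ≈ x
  ⊤⇒x≈x x = begin
    ⊤ ⇒ x         ≈⟨ ⊤-greatest (⊤ ⇒ x) ⟨
    ⊤ ∧ (⊤ ⇒ x)   ≈⟨ sh₁ ⊤ x ⟩
    ⊤ ∧ x         ≈⟨ ⊤-greatest x ⟩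
    x             ∎

  x∧x*≈⊥ : ∀ x → x ∧ (x *) ≈ ⊥
  x∧x*≈⊥ x = trans (sh₁ x ⊥) (x∧⊥≈⊥ x)

  ∧-⇒-relativise : ∀ {x y y′ z z′} → x ∧ y ≈ x ∧ y′ → x ∧ z ≈ x ∧ z′ →
                   x ∧ (y ⇒ z) ≈ x ∧ (y′ ⇒ z′)
  ∧-⇒-relativise {x} {y} {y′} {z} {z′} y≈y′ z≈z′ = begin
    x ∧ (y ⇒ z)                ≈⟨ sh₂ x y z ⟩
    x ∧ ((x ∧ y) ⇒ (x ∧ z))    ≈⟨ ∧-congˡ (⇒-cong y≈y′ z≈z′) ⟩
    x ∧ ((x ∧ y′) ⇒ (x ∧ z′))  ≈⟨ sh₂ x y′ z′ ⟨
    x ∧ (y′ ⇒ z′)              ∎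

  x∧y≈⊥⇒x∧y*≈x : ∀ {x y} → x ∧ y ≈ ⊥ → x ∧ (y *) ≈ x
  x∧y≈⊥⇒x∧y*≈x {x} {y} x∧y≈⊥ = begin
    x ∧ (y ⇒ ⊥)  ≈⟨ ∧-⇒-relativise (trans x∧y≈⊥ (sym (x∧⊥≈⊥ x))) refl ⟩
    x ∧ (⊥ ⇒ ⊥)  ≈⟨ ∧-congˡ (sh₃ ⊥) ⟩
    x ∧ ⊤        ≈⟨ x∧⊤≈x x ⟩
    x            ∎

  x∧y≈⊥⇒x*∧y≈⊥⇒y≈⊥ : ∀ {x y} → x ∧ y ≈ ⊥ → (x *) ∧ y ≈ ⊥ → y ≈ ⊥
  x∧y≈⊥⇒x*∧y≈⊥⇒y≈⊥ {x} {y} x∧y≈⊥ x*∧y≈⊥ = begin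
    y            ≈⟨ x∧y≈⊥⇒x∧y*≈x (trans (∧-comm y x) x∧y≈⊥) ⟨
    y ∧ (x *)    ≈⟨ ∧-comm y (x *) ⟩
    (x *) ∧ y    ≈⟨ x*∧y≈⊥ ⟩
    ⊥            ∎

  x∧[x*⇒x]≈x∧[⊥⇒⊤] : ∀ x → x ∧ ((x *) ⇒ x) ≈ x ∧ (⊥ ⇒ ⊤)
  x∧[x*⇒x]≈x∧[⊥⇒⊤] x = ∧-⇒-relativise
    (trans (x∧x*≈⊥ x) (sym (x∧⊥≈⊥ x)))
    (trans (∧-idem x) (sym (x∧⊤≈x x)))

  x*∧[x*⇒x]≈⊥ : ∀ x → (x *) ∧ ((x *) ⇒ x) ≈ ⊥
  x*∧[x*⇒x]≈⊥ x = begin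
    (x *) ∧ ((x *) ⇒ x)  ≈⟨ sh₁ (x *) x ⟩
    (x *) ∧ x            ≈⟨ ∧-comm (x *) x ⟩
    x ∧ (x *)            ≈⟨ x∧x*≈⊥ x ⟩
    ⊥                    ∎

  *-⇒-comm⇒⊥⇒⊤≈⊥ : (∀ x y → (x *) ⇒ (y *) ≈ (y *) ⇒ (x *)) → ⊥ ⇒ ⊤ ≈ ⊥
  *-⇒-comm⇒⊥⇒⊤≈⊥ *-⇒-comm = begin
    ⊥ ⇒ ⊤          ≈⟨ ⇒-cong (⊤⇒x≈x ⊥) (sh₃ ⊥) ⟨
    (⊤ *) ⇒ (⊥ *)  ≈⟨ *-⇒-comm ⊤ ⊥ ⟩
    (⊥ *) ⇒ (⊤ *)  ≈⟨ ⇒-cong (sh₃ ⊥) (⊤⇒x≈x ⊥) ⟩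
    ⊤ ⇒ ⊥          ≈⟨ ⊤⇒x≈x ⊥ ⟩
    ⊥              ∎

theorem8p3 : ∀ {c ℓ : Level} (A : SemiHeytingAlgebra c ℓ) →
    let open SemiHeytingAlgebra A in
    (∀ x y → (x *) ⇒ (y *) ≈ (y *) ⇒ (x *)) →
    ∀ x → ((x *) ⇒ x) * ≈ ⊤
theorem8p3 A *-⇒-comm x = trans (⇒-cong x*⇒x≈⊥ refl) (sh₃ ⊥)
  where
    open SemiHeytingAlgebra A
    open SemiHeytingAlgebraProperties A
    open SetoidReasoning setoid

    x∧[x*⇒x]≈⊥ : x ∧ ((x *) ⇒ x) ≈ ⊥
    x∧[x*⇒x]≈⊥ = begin
      x ∧ ((x *) ⇒ x)  ≈⟨ x∧[x*⇒x]≈x∧[⊥⇒⊤] x ⟩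
      x ∧ (⊥ ⇒ ⊤)      ≈⟨ ∧-congˡ (*-⇒-comm⇒⊥⇒⊤≈⊥ *-⇒-comm) ⟩
      x ∧ ⊥            ≈⟨ x∧⊥≈⊥ x ⟩
      ⊥                ∎

    x*⇒x≈⊥ : (x *) ⇒ x ≈ ⊥
    x*⇒x≈⊥ = x∧y≈⊥⇒x*∧y≈⊥⇒y≈⊥ x∧[x*⇒x]≈⊥ (x*∧[x*⇒x]≈⊥ x)
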